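{- Let $G=(S_1,S_2,E,w)$ be a one-player game in which all states belong to player 1, i.e. $S_2=\emptyset$. For every initial state $s_{init}\in S$ and every threshold $t\in\mathbb{Q}$: if player 1 has a winning strategy from $s_{init}$ for the objective $\mathrm{AvgEnergy}(t)$, then player 1 has a memoryless winning strategy from $s_{init}$ for $\mathrm{AvgEnergy}(t)$.
   Context: A game is a tuple $G=(S_1,S_2,E,w)$ where $S_1,S_2$ are disjoint finite sets of states (belonging to player 1 and player 2 respectively), $S=S_1\uplus S_2$, $E\subseteq S\times S$ is a set of edges such that every $s\in S$ has at least one $s'$ with $(s,s')\in E$, and $w\colon E\to\mathbb{Z}$ is a weight function. A play from $s_{init}$ is an infinite sequence $\pi=s_0s_1s_2\dots$ with $s_0=s_{init}$ and $(s_i,s_{i+1})\in E$ for all $i$; $\pi(n)=s_0\dots s_n$ denotes its prefix with $n$ edges. The energy level is $\mathrm{EL}(\pi(n))=\sum_{i=0}^{n-1}w(s_i,s_{i+1})$, and the average-energy of a play is $\overline{\mathrm{AE}}(\pi)=\limsup_{n\to\infty}\frac1n\sum_{i=1}^{n}\mathrm{EL}(\pi(i))$. A strategy of player $i$ is a function mapping every finite prefix whose last state is in $S_i$ to a state $s'$ with $(\text{last state},s')\in E$; it is memoryless if its choice depends only on the last state of the prefix. A play is consistent with a strategy if at every position where the current state belongs to the strategy's owner, the next state is the one chosen by the strategy. A strategy of player 1 is winning from $s_{init}$ for an objective $\mathcal{W}$ (a set of plays) if every play from $s_{init}$ consistent with it belongs to $\mathcal{W}$. The average-energy objective is $\mathrm{AvgEnergy}(t)=\{\pi\mid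 \overline{\mathrm{AE}}(\pi)\le t\}$ (player 1 aims to minimize the average-energy). -}

module Defs where

open import Data.Nat as ℕ using (ℕ; zero; suc)
open import Data.Integer as ℤ using (ℤ)
open import Data.Rational as ℚ using (ℚ; 0ℚ)
open import Data.Fin using (Fin)
open import Data.Bool using (Bool; true; false; T)
open import Data.Product using (Σ; ∃; _×_; _,_; proj₁; proj₂)
open import Data.List using (List; map; upTo)
open import Relation.Binary.PropositionalEquality using (_≡_)

-- A game with finitely many states Fin n.
--  * inS₁ s ≡ true  means s ∈ S₁ ; inS₁ s ≡ false means s ∈ S₂.
--  * E s s' ≡ true  means (s , s') ∈ E.
--  * w s s' is the weight of the edge (s , s') (values on non-edges are irrelevant).
record Game (n : ℕ) : Set where
  field
    inS₁  : Fin n → Bool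
    E     : Fin n → Fin n → Bool
    total : (s : Fin n) → Σ (Fin n) (λ s' → T (E s s'))
    w     : Fin n → Fin n → ℤ

module _ {n : ℕ} (G : Game n) where
  open Game G

  OnePlayer : Set
  OnePlayer = (s : Fin n) → inS₁ s ≡ true

  record Play (sinit : Fin n) : Set where
    field
      π     : ℕ → Fin n
      start : π 0 ≡ sinit
      edges : (i : ℕ) → T (E (π i) (π (suc i)))

  -- A finite prefix s₀ … s_k is given as the list of past states s₀ … s_{k-1}
  -- together with the last state s_k.
  Strategy₁ : Set
  Strategy₁ = (hist : List (Fin n)) (s : Fin n) → inS₁ s ≡ true →
              Σ (Fin n) (λ s' → T (E s s'))

  Memoryless : Strategy₁ → Set
  Memoryless σ = (h h' : List (Fin n)) (s : Fin n) (o : inS₁ s ≡ true) →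
                 proj₁ (σ h s o) ≡ proj₁ (σ h' s o)

  Consistent : {sinit : Fin n} → Strategy₁ → Play sinit → Set
  Consistent σ ρ = (i : ℕ) (o : inS₁ (π i) ≡ true) →
                   π (suc i) ≡ proj₁ (σ (map π (upTo i)) (π i) o)
    where open Play ρ

  EL : (ℕ → Fin n) → ℕ → ℤ
  EL π zero    = ℤ.+ 0
  EL π (suc k) = EL π k ℤ.+ w (π k) (π (suc k))

  sumEL : (ℕ → Fin n) → ℕ → ℤ
  sumEL π zero    = ℤ.+ 0
  sumEL π (suc m) = sumEL π m ℤ.+ EL π (suc m)

  -- limsup_{m→∞} (1/m) Σ_{i=1}^m EL(π(i)) ≤ t, unfolded as:
  -- for every rational ε > 0, eventually (1/m) Σ … ≤ t + ε.
  AvgEnergy : (t : ℚ) → (ℕ → Fin n) → Set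
  AvgEnergy t π = (ε : ℚ) → 0ℚ ℚ.< ε → ∃ λ N → (m : ℕ) → N ℕ.≤ m →
                  (sumEL π (suc m) ℚ./ suc m) ℚ.≤ t ℚ.+ ε

  Winning : Strategy₁ → (sinit : Fin n) → (t : ℚ) → Set
  Winning σ sinit t = (ρ : Play sinit) → Consistent σ ρ → AvgEnergy t (Play.π ρ)

-- In a one-player game the strategy σ produces a single play ρ, whose average energy is
-- at most t. Repeatedly cut the first simple cycle out of ρ. If some cut cycle is winning
-- (negative weight, or zero weight and mean energy at most t), the memoryless strategy
-- that follows the lasso leading to it and then loops on it wins. Otherwise, measured
-- against the slightly larger threshold t + 1/(nq) (q the denominator of t), each cut
-- costs at most a constant K, and nothing once the part of the play behind the cycle is
-- longer than K; as that part shrinks with every cut, every prefix of ρ has cost at least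
-- −(K + K²), so the average energy of ρ stays above t + ε for a fixed ε > 0, which is
-- a contradiction.
module Submission where

open import Defs
open import Data.Nat using (ℕ)
open import Data.Fin using (Fin)
open import Data.Rational using (ℚ)
open import Data.Product using (Σ; _×_)

open import Axiom.UniquenessOfIdentityProofs using (module Decidable⇒UIP)
open import Data.Bool as Bool using (T)
open import Data.Empty using (⊥-elim)
open import Data.Fin as Fin using (toℕ)
import Data.Fin.Properties as Fin
open import Data.Integer as ℤ using (ℤ; +_; -[1+_]; +[1+_]; _+_; _-_; _*_; -_; _≤_; _<_; 0ℤ; 1ℤ; ∣_∣)
import Data.Integer.Properties as ℤ
open import Data.Integer.Tactic.RingSolver using (solve-∀)
open import Data.List using (List; []; _∷ʳ_; map; upTo)
import Data.List.Properties as List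
open import Data.Nat as ℕ using (zero; suc; z≤n; s≤s)
open import Data.Nat.Coprimality using (1-coprimeTo)
open import Data.Nat.Induction using (<-rec)
import Data.Nat.Properties as ℕ
open import Algebra.Properties.CommutativeSemigroup ℕ.+-commutativeSemigroup using (x∙yz≈y∙xz)
open import Data.Product using (∃; _,_; proj₁; proj₂)
open import Data.Rational as ℚ using (mkℚ; ↥_; ↧_)
import Data.Rational.Properties as ℚ
import Data.Rational.Unnormalised as ℚᵘ
import Data.Rational.Unnormalised.Properties as ℚᵘ
open import Data.Sum as Sum using (_⊎_; inj₁; inj₂)
open import Function.Bundles using (_⇔_; mk⇔; Equivalence)
open import Relation.Binary.Definitions using (Tri; tri<; tri≈; tri>)
open import Relation.Binary.PropositionalEquality
open import Relation.Nullary using (¬_; Dec; yes; no)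
open import Relation.Nullary.Decidable using (_⊎-dec_; _×-dec_)

-- Integer arithmetic
--
-- Several proofs exhibit the difference of the two sides of an inequality as a sum of
-- products of non-negative terms; the ring solver checks the identity.

i≤+∣i∣ : ∀ i → i ≤ + ∣ i ∣
i≤+∣i∣ (+ n) = ℤ.≤-refl
i≤+∣i∣ -[1+ n ] = ℤ.-≤+

0≤* : ∀ {x y} → 0ℤ ≤ x → 0ℤ ≤ y → 0ℤ ≤ x * y
0≤* {x} {y} 0≤x 0≤y =
  subst (_≤ x * y) (ℤ.*-zeroˡ y) (ℤ.*-monoʳ-≤-nonNeg y {{ℤ.nonNegative 0≤y}} 0≤x)

i-j≤k⇒i≤k+j : ∀ {i j k} → i - j ≤ k → i ≤ k + j
i-j≤k⇒i≤k+j {i} {j} {k} i-j≤k = subst (_≤ k + j) (cancel i j) (ℤ.+-monoˡ-≤ j i-j≤k)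
  where
  cancel : ∀ i j → i - j + j ≡ i
  cancel = solve-∀

+-minus-comm : ∀ x y z → x + y - z ≡ x - z + y
+-minus-comm = solve-∀

neg-*-suc : ∀ k c → - (k * c) + - c ≡ - ((1ℤ + k) * c)
neg-*-suc = solve-∀

-[m∸n]≤n-m : ∀ m n → - (+ (m ℕ.∸ n)) ≤ + n - + m
-[m∸n]≤n-m m n with n ℕ.≤? m
... | yes n≤m = ℤ.≤-reflexive (sym (trans (ℤ.m-n≡m⊖n n m) (ℤ.⊖-≤ n≤m)))
... | no n≰m = subst₂ _≤_ (cong (λ k → - (+ k)) (sym (ℕ.m≤n⇒m∸n≡0 m≤n)))
                          (sym (trans (ℤ.m-n≡m⊖n n m) (ℤ.⊖-≥ m≤n))) (ℤ.+≤+ z≤n)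
  where m≤n = ℕ.<⇒≤ (ℕ.≰⇒> n≰m)

eventually-nonpositive : ∀ d a k r → ∣ d ∣ ℕ.≤ r → d + +[1+ a ] * (+ r * -[1+ k ]) ≤ 0ℤ
eventually-nonpositive d a k r ∣d∣≤r =
  ℤ.0≤i-j⇒j≤i (subst (0ℤ ≤_) (regroup d +[1+ a ] -[1+ k ] (+ r))
    (ℤ.+-mono-≤ (ℤ.i≤j⇒0≤j-i (ℤ.≤-trans (i≤+∣i∣ d) (ℤ.+≤+ ∣d∣≤r)))
                (0≤* {+[1+ a ] * +[1+ k ] - 1ℤ} (ℤ.+≤+ z≤n) (ℤ.+≤+ z≤n))))
  where
  regroup : ∀ d q w r → (r - d) + (q * - w - 1ℤ) * r ≡ 0ℤ - (d + q * (r * w))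
  regroup = solve-∀

stretch-cost-lower : ∀ {N Q A b L S} → 0ℤ ≤ Q → 0ℤ ≤ b → 0ℤ ≤ L → L ≤ N → - (L * b) ≤ S →
                     - (N * (Q * b + + ∣ A ∣)) ≤ Q * S - L * A
stretch-cost-lower {N} {Q} {A} {b} {L} {S} 0≤Q 0≤b 0≤L L≤N S-lower = begin
  - (N * (Q * b + + ∣ A ∣))
    ≤⟨ ℤ.neg-mono-≤ (ℤ.*-monoʳ-≤-nonNeg (Q * b + + ∣ A ∣) {{ℤ.nonNegative 0≤K}} L≤N) ⟩
  - (L * (Q * b + + ∣ A ∣))
    ≡⟨ expand L Q b (+ ∣ A ∣) ⟩
  Q * - (L * b) - L * + ∣ A ∣
    ≤⟨ ℤ.+-mono-≤ (ℤ.*-monoˡ-≤-nonNeg Q {{ℤ.nonNegative 0≤Q}} S-lower)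
                  (ℤ.neg-mono-≤ (ℤ.*-monoˡ-≤-nonNeg L {{ℤ.nonNegative 0≤L}} (i≤+∣i∣ A))) ⟩
  Q * S - L * A ∎
  where
  open ℤ.≤-Reasoning
  0≤K : 0ℤ ≤ Q * b + + ∣ A ∣
  0≤K = ℤ.+-mono-≤ (0≤* 0≤Q 0≤b) (ℤ.+≤+ z≤n)
  expand : ∀ L Q b a → - (L * (Q * b + a)) ≡ Q * - (L * b) - L * a
  expand = solve-∀

zero-cycle-cost : ∀ {N q p S L} → 0ℤ ≤ N → L ≤ N → p * L < q * S →
                  0ℤ ≤ (N * q) * S - L * (N * p + 1ℤ)
zero-cycle-cost {N} {q} {p} {S} {L} 0≤N L≤N pL<qS = subst (0ℤ ≤_) (regroup N q p S L)
  (ℤ.+-mono-≤ (0≤* 0≤N (ℤ.i≤j⇒0≤j-i (ℤ.i<j⇒suc[i]≤j pL<qS))) (ℤ.i≤j⇒0≤j-i L≤N))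
  where
  regroup : ∀ N q p S L → N * (q * S - (1ℤ + p * L)) + (N - L) ≡ (N * q) * S - L * (N * p + 1ℤ)
  regroup = solve-∀

positive-cycle-cost : ∀ {Q S W A L K d} → 1ℤ ≤ Q → 0ℤ < W → 0ℤ ≤ d → - K ≤ Q * S - L * A →
                      d - K ≤ Q * (S + d * W) - L * A
positive-cycle-cost {Q} {S} {W} {A} {L} {K} {d} 1≤Q 0<W 0≤d stretch =
  ℤ.0≤i-j⇒j≤i (subst (0ℤ ≤_) (regroup Q S W A L K d)
    (ℤ.+-mono-≤ (ℤ.+-mono-≤ (ℤ.i≤j⇒0≤j-i stretch)
                            (0≤* (ℤ.i≤j⇒0≤j-i 1≤Q) (0≤* 0≤d (ℤ.<⇒≤ 0<W))))
                (0≤* 0≤d (ℤ.i≤j⇒0≤j-i (ℤ.i<j⇒suc[i]≤j 0<W)))))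
  where
  regroup : ∀ Q S W A L K d → (Q * S - L * A - - K) + (Q - 1ℤ) * (d * W) + d * (W - 1ℤ)
                              ≡ (Q * (S + d * W) - L * A) - (d - K)
  regroup = solve-∀

potential-step : ∀ K {d b} → d ℕ.< b → K ℕ.* (d ℕ.⊓ K) ℕ.+ (K ℕ.∸ d) ℕ.≤ K ℕ.* (b ℕ.⊓ K)
potential-step K {d} {b} d<b with d ℕ.<? K
... | yes d<K = begin
  K ℕ.* (d ℕ.⊓ K) ℕ.+ (K ℕ.∸ d) ≡⟨ cong (λ x → K ℕ.* x ℕ.+ (K ℕ.∸ d)) (ℕ.m≤n⇒m⊓n≡m (ℕ.<⇒≤ d<K)) ⟩
  K ℕ.* d ℕ.+ (K ℕ.∸ d)         ≤⟨ ℕ.+-monoʳ-≤ (K ℕ.* d) (ℕ.m∸n≤m K d) ⟩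
  K ℕ.* d ℕ.+ K                 ≡⟨ ℕ.+-comm (K ℕ.* d) K ⟩
  K ℕ.+ K ℕ.* d                 ≡⟨ ℕ.*-suc K d ⟨
  K ℕ.* suc d                   ≤⟨ ℕ.*-monoʳ-≤ K (ℕ.⊓-glb d<b d<K) ⟩
  K ℕ.* (b ℕ.⊓ K)               ∎
  where open ℕ.≤-Reasoning
... | no d≮K = begin
  K ℕ.* (d ℕ.⊓ K) ℕ.+ (K ℕ.∸ d)
    ≡⟨ cong₂ (λ x y → K ℕ.* x ℕ.+ y) (ℕ.m≥n⇒m⊓n≡n K≤d) (ℕ.m≤n⇒m∸n≡0 K≤d) ⟩
  K ℕ.* K ℕ.+ 0
    ≡⟨ ℕ.+-identityʳ (K ℕ.* K) ⟩
  K ℕ.* K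
    ≡⟨ cong (K ℕ.*_) (ℕ.m≥n⇒m⊓n≡n (ℕ.≤-trans K≤d (ℕ.<⇒≤ d<b))) ⟨
  K ℕ.* (b ℕ.⊓ K) ∎
  where
  open ℕ.≤-Reasoning
  K≤d = ℕ.≮⇒≥ d≮K

average-gap : ∀ {N q p s M K} → 0ℤ ≤ N → 0ℤ ≤ q →
              s * (q * (1ℤ + N * q)) ≤ (p * (1ℤ + N * q) + 1ℤ * q) * M →
              - K ≤ (N * q) * s - M * (N * p + 1ℤ) →
              M ≤ (1ℤ + N * q) * K
average-gap {N} {q} {p} {s} {M} {K} 0≤N 0≤q average-small cost-large =
  ℤ.0≤i-j⇒j≤i (subst (0ℤ ≤_) (regroup N q p s M K)
    (ℤ.+-mono-≤ (0≤* (ℤ.+-mono-≤ (ℤ.+≤+ z≤n) (0≤* 0≤N 0≤q)) (ℤ.i≤j⇒0≤j-i cost-large))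
                (0≤* 0≤N (ℤ.i≤j⇒0≤j-i average-small))))
  where
  regroup : ∀ N q p s M K → (1ℤ + N * q) * ((N * q) * s - M * (N * p + 1ℤ) - - K)
                            + N * ((p * (1ℤ + N * q) + 1ℤ * q) * M - s * (q * (1ℤ + N * q)))
                            ≡ (1ℤ + N * q) * K - M
  regroup = solve-∀

-- Bounded sequences and rational averages

bounded-above : ∀ {m} (f : Fin m → ℤ) → ∃ λ C → ∀ x → f x ≤ C
bounded-above {zero} f = 0ℤ , λ ()
bounded-above {suc m} f with bounded-above (λ x → f (Fin.suc x))
... | C , bound = f Fin.zero ℤ.⊔ C , λ
  { Fin.zero → ℤ.i≤i⊔j _ C
  ; (Fin.suc x) → ℤ.i≤j⇒i≤k⊔j (f Fin.zero) (bound x) }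

eventually-periodic-descent⇒bounded : ∀ (F : ℕ → ℤ) {i j R} → i ℕ.< j →
                                      (∀ r → R ℕ.≤ r → F (r ℕ.+ j) ≤ F (r ℕ.+ i)) →
                                      ∃ λ C → ∀ m → F m ≤ C
eventually-periodic-descent⇒bounded F {i} {j} {R} i<j descends =
  C , <-rec (λ m → F m ≤ C) bounded
  where
  initial = bounded-above (λ (x : Fin (R ℕ.+ j)) → F (toℕ x))
  C = proj₁ initial
  bounded : ∀ m → (∀ {k} → k ℕ.< m → F k ≤ C) → F m ≤ C
  bounded m rec with m ℕ.<? R ℕ.+ j
  ... | yes m<R+j =
    subst (λ k → F k ≤ C) (Fin.toℕ-fromℕ< m<R+j) (proj₂ initial (Fin.fromℕ< m<R+j))
  ... | no m≮R+j = subst (λ k → F k ≤ C) r+j≡m (ℤ.≤-trans (descends r R≤r) (rec r+i<m))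
    where
    r = m ℕ.∸ j
    r+j≡m : r ℕ.+ j ≡ m
    r+j≡m = ℕ.m∸n+n≡m (ℕ.m+n≤o⇒n≤o R (ℕ.≮⇒≥ m≮R+j))
    R≤r : R ℕ.≤ r
    R≤r = ℕ.+-cancelʳ-≤ j R r (subst (R ℕ.+ j ℕ.≤_) (sym r+j≡m) (ℕ.≮⇒≥ m≮R+j))
    r+i<m : r ℕ.+ i ℕ.< m
    r+i<m = subst (r ℕ.+ i ℕ.<_) r+j≡m (ℕ.+-monoʳ-< r i<j)

/≤+⇔ : ∀ x m t e →
       (x ℚ./ suc m ℚ.≤ t ℚ.+ e) ⇔ (x * (↧ t * ↧ e) ≤ (↥ t * ↧ e + ↥ e * ↧ t) * + suc m)
/≤+⇔ x m t@(mkℚ _ _ _) e@(mkℚ _ _ _) = mk⇔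
  (λ le → ℚᵘ.drop-*≤* (ℚᵘ.≤-respʳ-≃ (ℚ.toℚᵘ-homo-+ t e)
            (ℚᵘ.≤-respˡ-≃ (ℚ.toℚᵘ-fromℚᵘ (ℚᵘ.mkℚᵘ x m)) (ℚ.toℚᵘ-mono-≤ le))))
  (λ le → ℚ.toℚᵘ-cancel-≤ (ℚᵘ.≤-respʳ-≃ (ℚᵘ.≃-sym (ℚ.toℚᵘ-homo-+ t e))
            (ℚᵘ.≤-respˡ-≃ (ℚᵘ.≃-sym (ℚ.toℚᵘ-fromℚᵘ (ℚᵘ.mkℚᵘ x m))) (ℚᵘ.*≤* le))))

bounded-excess⇒average-≤ : ∀ (x : ℕ → ℤ) (t : ℚ) (C : ℤ) → (∀ m → ↧ t * x m - + m * ↥ t ≤ C) →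
                           ∀ ε → ℚ.0ℚ ℚ.< ε →
                           ∃ λ N → ∀ m → N ℕ.≤ m → x (suc m) ℚ./ suc m ℚ.≤ t ℚ.+ ε
bounded-excess⇒average-≤ x t C bound (mkℚ (+ 0) b _) (ℚ.*<* (ℤ.+<+ ()))
bounded-excess⇒average-≤ x t C bound (mkℚ -[1+ a ] b _) (ℚ.*<* ())
bounded-excess⇒average-≤ x t C bound ε@(mkℚ +[1+ a ] b _) _ = ∣ C ∣ ℕ.* suc b , λ m N≤m →
  Equivalence.from (/≤+⇔ (x (suc m)) m t ε) (begin
    x (suc m) * (q * + suc b)
      ≡⟨ e₁ (x (suc m)) q (+ suc b) ⟩
    (q * x (suc m)) * + suc b
      ≤⟨ ℤ.*-monoʳ-≤-nonNeg (+ suc b) (i-j≤k⇒i≤k+j {q * x (suc m)} (bound (suc m))) ⟩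
    (C + + suc m * p) * + suc b
      ≡⟨ e₂ C (+ suc m) p (+ suc b) ⟩
    C * + suc b + p * + suc b * + suc m
      ≤⟨ ℤ.+-monoˡ-≤ (p * + suc b * + suc m) (slack m N≤m) ⟩
    +[1+ a ] * q * + suc m + p * + suc b * + suc m
      ≡⟨ e₃ (+[1+ a ] * q) (p * + suc b) (+ suc m) ⟩
    (p * + suc b + +[1+ a ] * q) * + suc m ∎)
  where
  open ℤ.≤-Reasoning
  p = ↥ t
  q = ↧ t
  e₁ : ∀ x q b → x * (q * b) ≡ (q * x) * b
  e₁ = solve-∀
  e₂ : ∀ c m p b → (c + m * p) * b ≡ c * b + p * b * m
  e₂ = solve-∀
  e₃ : ∀ u v m → u * m + v * m ≡ (v + u) * m
  e₃ = solve-∀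
  slack : ∀ m → ∣ C ∣ ℕ.* suc b ℕ.≤ m → C * + suc b ≤ +[1+ a ] * q * + suc m
  slack m N≤m = begin
    C * + suc b            ≤⟨ ℤ.*-monoʳ-≤-nonNeg (+ suc b) (i≤+∣i∣ C) ⟩
    + ∣ C ∣ * + suc b      ≡⟨ ℤ.pos-* ∣ C ∣ (suc b) ⟨
    + (∣ C ∣ ℕ.* suc b)    ≤⟨ ℤ.+≤+ (ℕ.m≤n⇒m≤1+n N≤m) ⟩
    + suc m                ≡⟨ ℤ.*-identityˡ (+ suc m) ⟨
    1ℤ * + suc m           ≤⟨ ℤ.*-monoʳ-≤-nonNeg (+ suc m) {1ℤ} {+[1+ a ] * q} (ℤ.+≤+ (s≤s z≤n)) ⟩
    +[1+ a ] * q * + suc m ∎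

-- Sequences over a finite set

module _ {A : Set} (f : A → A) {τ : ℕ → A} (step : ∀ k → τ (suc k) ≡ f (τ k)) where

  iterate-agree : ∀ {π : ℕ → A} {K} → τ 0 ≡ π 0 → (∀ {k} → k ℕ.< K → f (π k) ≡ π (suc k)) →
                  ∀ {k} → k ℕ.≤ K → τ k ≡ π k
  iterate-agree start follows {zero} _ = start
  iterate-agree start follows {suc k} k<K =
    trans (step k) (trans (cong f (iterate-agree start follows (ℕ.<⇒≤ k<K))) (follows k<K))

  iterate-shift : ∀ {a b} → τ a ≡ τ b → ∀ r → τ (r ℕ.+ a) ≡ τ (r ℕ.+ b)
  iterate-shift τa≡τb zero = τa≡τb
  iterate-shift τa≡τb (suc r) =
    trans (step _) (trans (cong f (iterate-shift τa≡τb r)) (sym (step _)))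

module _ {n : ℕ} where

  InjectiveBelow : (ℕ → Fin n) → ℕ → Set
  InjectiveBelow ρ k = ∀ {a b} → a ℕ.< k → b ℕ.< k → ρ a ≡ ρ b → a ≡ b

  injectiveBelow⇒≤ : ∀ {ρ k} → InjectiveBelow ρ k → k ℕ.≤ n
  injectiveBelow⇒≤ {ρ} {k} inj with k ℕ.≤? n
  ... | yes k≤n = k≤n
  ... | no k≰n with Fin.pigeonhole (ℕ.n<1+n n) (λ x → ρ (toℕ x))
  ...   | x , y , x<y , ρx≡ρy = ⊥-elim (ℕ.<⇒≢ x<y (inj (below x) (below y) ρx≡ρy))
    where
    below : (x : Fin (suc n)) → toℕ x ℕ.< k
    below x = ℕ.<-≤-trans (Fin.toℕ<n x) (ℕ.≰⇒> k≰n)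

  record FirstRepetition (ρ : ℕ → Fin n) : Set where
    field
      i l : ℕ
    j : ℕ
    j = suc l ℕ.+ i
    field
      repeats   : ρ i ≡ ρ j
      injective : InjectiveBelow ρ j

    i<j : i ℕ.< j
    i<j = ℕ.m<n+m i ℕ.z<s

    j≤n : j ℕ.≤ n
    j≤n = injectiveBelow⇒≤ injective

  injectiveBelow-or-repetition : ∀ ρ k → InjectiveBelow ρ k ⊎ FirstRepetition ρ
  injectiveBelow-or-repetition ρ zero = inj₁ λ ()
  injectiveBelow-or-repetition ρ (suc k) with injectiveBelow-or-repetition ρ k
  ... | inj₂ fr = inj₂ fr
  ... | inj₁ inj with ℕ.anyUpTo? (λ a → ρ a Fin.≟ ρ k) k
  ...   | yes (a , a<k , ρa≡ρk) = inj₂ record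
    { i = a ; l = k ℕ.∸ suc a
    ; repeats = trans ρa≡ρk (cong ρ k≡j) ; injective = subst (InjectiveBelow ρ) k≡j inj }
    where
    k≡j : k ≡ suc (k ℕ.∸ suc a) ℕ.+ a
    k≡j = trans (sym (ℕ.m∸n+n≡m a<k)) (ℕ.+-suc (k ℕ.∸ suc a) a)
  ...   | no fresh = inj₁ extend
    where
    extend : InjectiveBelow ρ (suc k)
    extend {a} {b} a<sk b<sk ρa≡ρb with ℕ.m<1+n⇒m<n∨m≡n a<sk | ℕ.m<1+n⇒m<n∨m≡n b<sk
    ... | inj₁ a<k | inj₁ b<k = inj a<k b<k ρa≡ρb
    ... | inj₂ refl | inj₂ refl = refl
    ... | inj₁ a<k | inj₂ refl = ⊥-elim (fresh (a , a<k , ρa≡ρb))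
    ... | inj₂ refl | inj₁ b<k = ⊥-elim (fresh (b , b<k , sym ρa≡ρb))

  firstRepetition : ∀ ρ → FirstRepetition ρ
  firstRepetition ρ with injectiveBelow-or-repetition ρ (suc n)
  ... | inj₁ inj = ⊥-elim (ℕ.<-irrefl refl (injectiveBelow⇒≤ inj))
  ... | inj₂ fr = fr

  repetition-beyond-prefix : ∀ {π π' : ℕ → Fin n} {a b} → (∀ {k} → k ℕ.≤ a → π' k ≡ π k) →
                             InjectiveBelow π b → a ℕ.< b → (fr : FirstRepetition π') →
                             a ℕ.< FirstRepetition.j fr
  repetition-beyond-prefix {π} {π'} {a} {b} agree inj a<b fr with a ℕ.<? FirstRepetition.j fr
  ... | yes a<j = a<j
  ... | no a≮j = ⊥-elim (ℕ.<⇒≢ i<j (inj (below i≤a) (below j≤a) πi≡πj))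
    where
    open FirstRepetition fr
    j≤a = ℕ.≮⇒≥ a≮j
    i≤a = ℕ.<⇒≤ (ℕ.<-≤-trans i<j j≤a)
    below : ∀ {k} → k ℕ.≤ a → k ℕ.< b
    below k≤a = ℕ.≤-<-trans k≤a a<b
    πi≡πj : π i ≡ π j
    πi≡πj = trans (sym (agree i≤a)) (trans repeats (agree j≤a))

-- Energy along sequences of states

module _ {n : ℕ} (G : Game n) where
  open Game G

  weights-bounded-below : ∃ λ c → ∀ s s' → - (+ c) ≤ w s s'
  weights-bounded-below = ∣ C ∣ , λ s s' → ℤ.≤-trans (ℤ.neg-mono-≤ (i≤+∣i∣ C)) (-C≤w s s')
    where
    inner : ∀ s → ∃ λ C → ∀ s' → - w s s' ≤ C
    inner s = bounded-above (λ s' → - w s s')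
    outer = bounded-above (λ s → proj₁ (inner s))
    C = proj₁ outer
    -C≤w : ∀ s s' → - C ≤ w s s'
    -C≤w s s' = subst (- C ≤_) (ℤ.neg-involutive (w s s'))
      (ℤ.neg-mono-≤ (ℤ.≤-trans (proj₂ (inner s) s') (proj₂ outer s)))

  energyFloor : ℤ
  energyFloor = + n * + proj₁ weights-bounded-below

  ΔEL ΔsumEL : (ℕ → Fin n) → ℕ → ℕ → ℤ
  ΔEL π a b = EL G π b - EL G π a
  ΔsumEL π a b = sumEL G π b - sumEL G π a

  EL-lower : ∀ π k → k ℕ.≤ n → - energyFloor ≤ EL G π k
  EL-lower π k k≤n = ℤ.≤-trans (ℤ.neg-mono-≤ (ℤ.*-monoʳ-≤-nonNeg (+ c) (ℤ.+≤+ k≤n))) (go k)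
    where
    c = proj₁ weights-bounded-below
    go : ∀ k → - (+ k * + c) ≤ EL G π k
    go zero = ℤ.≤-refl
    go (suc k) = subst (_≤ EL G π (suc k)) (neg-*-suc (+ k) (+ c))
      (ℤ.+-mono-≤ (go k) (proj₂ weights-bounded-below (π k) (π (suc k))))

  ΔsumEL-lower : ∀ π a r → r ℕ.+ a ℕ.≤ n → - (+ r * energyFloor) ≤ ΔsumEL π a (r ℕ.+ a)
  ΔsumEL-lower π a zero _ = ℤ.≤-reflexive (sym (ℤ.+-inverseʳ (sumEL G π a)))
  ΔsumEL-lower π a (suc r) le =
    subst₂ _≤_ (neg-*-suc (+ r) energyFloor) (sym (+-minus-comm (sumEL G π (r ℕ.+ a)) _ _))
      (ℤ.+-mono-≤ (ΔsumEL-lower π a r (ℕ.<⇒≤ le)) (EL-lower π (suc r ℕ.+ a) le))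

  sumEL-lower : ∀ π m → m ℕ.≤ n → - (+ m * energyFloor) ≤ sumEL G π m
  sumEL-lower π m m≤n = subst (- (+ m * energyFloor) ≤_)
    (trans (ℤ.+-identityʳ _) (cong (sumEL G π) (ℕ.+-identityʳ m)))
    (ΔsumEL-lower π 0 m (subst (ℕ._≤ n) (sym (ℕ.+-identityʳ m)) m≤n))

  EL-cong : ∀ {π π' : ℕ → Fin n} {K} → (∀ {k} → k ℕ.≤ K → π' k ≡ π k) →
            ∀ {k} → k ℕ.≤ K → EL G π' k ≡ EL G π k
  EL-cong agree {zero} _ = refl
  EL-cong agree {suc k} k<K =
    cong₂ _+_ (EL-cong agree (ℕ.<⇒≤ k<K)) (cong₂ w (agree (ℕ.<⇒≤ k<K)) (agree k<K))

  sumEL-cong : ∀ {π π' : ℕ → Fin n} {K} → (∀ {k} → k ℕ.≤ K → π' k ≡ π k) →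
               ∀ {k} → k ℕ.≤ K → sumEL G π' k ≡ sumEL G π k
  sumEL-cong agree {zero} _ = refl
  sumEL-cong agree {suc k} k<K = cong₂ _+_ (sumEL-cong agree (ℕ.<⇒≤ k<K)) (EL-cong agree k<K)

  module _ {π π' : ℕ → Fin n} {a b : ℕ} (shift : ∀ r → π' (r ℕ.+ a) ≡ π (r ℕ.+ b)) where

    EL-shift : ∀ r → ΔEL π' a (r ℕ.+ a) ≡ ΔEL π b (r ℕ.+ b)
    EL-shift zero = trans (ℤ.+-inverseʳ (EL G π' a)) (sym (ℤ.+-inverseʳ (EL G π b)))
    EL-shift (suc r) = begin
      EL G π' (r ℕ.+ a) + w (π' (r ℕ.+ a)) (π' (suc r ℕ.+ a)) - EL G π' a
        ≡⟨ +-minus-comm (EL G π' (r ℕ.+ a)) _ (EL G π' a) ⟩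
      ΔEL π' a (r ℕ.+ a) + w (π' (r ℕ.+ a)) (π' (suc r ℕ.+ a))
        ≡⟨ cong₂ _+_ (EL-shift r) (cong₂ w (shift r) (shift (suc r))) ⟩
      ΔEL π b (r ℕ.+ b) + w (π (r ℕ.+ b)) (π (suc r ℕ.+ b))
        ≡⟨ +-minus-comm (EL G π (r ℕ.+ b)) _ (EL G π b) ⟨
      EL G π (r ℕ.+ b) + w (π (r ℕ.+ b)) (π (suc r ℕ.+ b)) - EL G π b ∎
      where open ≡-Reasoning

    sumEL-shift : ∀ r → ΔsumEL π' a (r ℕ.+ a) - + r * EL G π' a ≡
                        ΔsumEL π b (r ℕ.+ b) - + r * EL G π b
    sumEL-shift zero =
      trans (vanish (sumEL G π' a) (EL G π' a)) (sym (vanish (sumEL G π b) (EL G π b)))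
      where
      vanish : ∀ x e → x - x - 0ℤ * e ≡ 0ℤ
      vanish = solve-∀
    sumEL-shift (suc r) =
      trans (regroup (sumEL G π' (r ℕ.+ a)) (EL G π' (suc r ℕ.+ a)) (sumEL G π' a) (+ r) (EL G π' a))
        (trans (cong₂ _+_ (sumEL-shift r) (EL-shift (suc r)))
          (sym (regroup (sumEL G π (r ℕ.+ b)) (EL G π (suc r ℕ.+ b)) (sumEL G π b) (+ r) (EL G π b))))
      where
      regroup : ∀ x e y r c → x + e - y - (1ℤ + r) * c ≡ (x - y - r * c) + (e - c)
      regroup = solve-∀

  -- π' is π with the segment between a and b removed; when π' = π this says that
  -- π is periodic from a on, with period b − a.
  record Splice (π π' : ℕ → Fin n) (a b : ℕ) : Set where
    field
      prefix : ∀ {k} → k ℕ.≤ a → π' k ≡ π k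
      suffix : ∀ r → π' (r ℕ.+ a) ≡ π (r ℕ.+ b)

    sumEL-splice : ∀ r →
                   sumEL G π (r ℕ.+ b) ≡ sumEL G π' (r ℕ.+ a) + ΔsumEL π a b + + r * ΔEL π a b
    sumEL-splice r = rearrange (sumEL G π' (r ℕ.+ a)) (sumEL G π (r ℕ.+ b)) _ _ _ _ (+ r)
      (subst₂ (λ s e → sumEL G π' (r ℕ.+ a) - s - + r * e ≡ ΔsumEL π b (r ℕ.+ b) - + r * EL G π b)
        (sumEL-cong prefix ℕ.≤-refl) (EL-cong prefix ℕ.≤-refl) (sumEL-shift suffix r))
      where
      rearrange : ∀ x' x sa sb ea eb r → x' - sa - r * ea ≡ x - sb - r * eb →
                  x ≡ x' + (sb - sa) + r * (eb - ea)
      rearrange x' x sa sb ea eb r e = begin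
        x                                ≡⟨ restore x sb r eb ⟩
        (x - sb - r * eb) + sb + r * eb  ≡⟨ cong (λ y → y + sb + r * eb) e ⟨
        (x' - sa - r * ea) + sb + r * eb ≡⟨ collect x' sa r ea sb eb ⟩
        x' + (sb - sa) + r * (eb - ea)   ∎
        where
        open ≡-Reasoning
        restore : ∀ x sb r eb → x ≡ (x - sb - r * eb) + sb + r * eb
        restore = solve-∀
        collect : ∀ x' sa r ea sb eb →
                  (x' - sa - r * ea) + sb + r * eb ≡ x' + (sb - sa) + r * (eb - ea)
        collect = solve-∀

    edges-splice : (∀ k → T (E (π k) (π (suc k)))) → ∀ k → T (E (π' k) (π' (suc k)))
    edges-splice edges k with suc k ℕ.≤? a
    ... | yes k<a =
      subst₂ (λ x y → T (E x y)) (sym (prefix (ℕ.<⇒≤ k<a))) (sym (prefix k<a)) (edges k)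
    ... | no k≮a = subst (λ k → T (E (π' k) (π' (suc k)))) (ℕ.m∸n+n≡m (ℕ.≮⇒≥ k≮a))
      (subst₂ (λ x y → T (E x y)) (sym (suffix r)) (sym (suffix (suc r))) (edges (r ℕ.+ b)))
      where r = k ℕ.∸ a

  -- Q·m times the excess of the average energy of π up to m over P/Q.
  excess : ℤ → ℤ → (ℕ → Fin n) → ℕ → ℤ
  excess Q P π m = Q * sumEL G π m - + m * P

  excess-splice : ∀ {π π' a L} → Splice π π' a (L ℕ.+ a) → ∀ Q P r →
                  excess Q P π (r ℕ.+ (L ℕ.+ a)) ≡
                  excess Q P π' (r ℕ.+ a) +
                    (Q * (ΔsumEL π a (L ℕ.+ a) + + r * ΔEL π a (L ℕ.+ a)) - + L * P)
  excess-splice {π} {π'} {a} {L} sp Q P r = begin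
    Q * sumEL G π (r ℕ.+ b) - + (r ℕ.+ b) * P
      ≡⟨ cong₂ (λ x y → Q * x - y * P) (Splice.sumEL-splice sp r) +[r+b]≡+[r+a]+L ⟩
    Q * (sumEL G π' (r ℕ.+ a) + S + + r * W) - (+ (r ℕ.+ a) + + L) * P
      ≡⟨ regroup Q (sumEL G π' (r ℕ.+ a)) S (+ r) W (+ (r ℕ.+ a)) (+ L) P ⟩
    excess Q P π' (r ℕ.+ a) + (Q * (S + + r * W) - + L * P) ∎
    where
    open ≡-Reasoning
    b = L ℕ.+ a
    S = ΔsumEL π a b
    W = ΔEL π a b
    +[r+b]≡+[r+a]+L : + (r ℕ.+ b) ≡ + (r ℕ.+ a) + + L
    +[r+b]≡+[r+a]+L = trans (cong +_ (trans (x∙yz≈y∙xz r L a) (ℕ.+-comm L (r ℕ.+ a)))) (ℤ.pos-+ (r ℕ.+ a) L)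
    regroup : ∀ Q x s r w m L P → Q * (x + s + r * w) - (m + L) * P ≡
                                  (Q * x - m * P) + (Q * (s + r * w) - L * P)
    regroup = solve-∀

  cut : (ℕ → Fin n) → ℕ → ℕ → ℕ → Fin n
  cut π i l k with k ℕ.≤? i
  ... | yes _ = π k
  ... | no _  = π (suc l ℕ.+ k)

  cut-splice : ∀ {π} (fr : FirstRepetition π) → let open FirstRepetition fr in Splice π (cut π i l) i j
  cut-splice {π} fr = record { prefix = cut-prefix ; suffix = cut-suffix }
    where
    open FirstRepetition fr
    cut-prefix : ∀ {k} → k ℕ.≤ i → cut π i l k ≡ π k
    cut-prefix {k} k≤i with k ℕ.≤? i
    ... | yes _ = refl
    ... | no k≰i = ⊥-elim (k≰i k≤i)
    cut-suffix : ∀ r → cut π i l (r ℕ.+ i) ≡ π (r ℕ.+ j)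
    cut-suffix zero = trans (cut-prefix ℕ.≤-refl) repeats
    cut-suffix (suc r) with suc r ℕ.+ i ℕ.≤? i
    ... | yes r+i<i = ⊥-elim (ℕ.<-irrefl refl (ℕ.<-≤-trans (ℕ.m<n+m i ℕ.z<s) r+i<i))
    ... | no _ = cong π (x∙yz≈y∙xz (suc l) (suc r) i)

  cutCycle : ∀ {sinit} (ρ : Play G sinit) → FirstRepetition (Play.π ρ) → Play G sinit
  cutCycle ρ fr = record
    { π = cut π i l
    ; start = trans (Splice.prefix (cut-splice fr) z≤n) start
    ; edges = Splice.edges-splice (cut-splice fr) edges }
    where
    open Play ρ
    open FirstRepetition fr

  module _ (t : ℚ) {π : ℕ → Fin n} (fr : FirstRepetition π) where
    open FirstRepetition fr

    -- The lasso π[0..i] (π[i..j])^ω has average energy −∞ (negative cycle) or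
    -- ΔsumEL π i j / suc l (zero cycle); this says that it is at most t.
    WinningCycle : Set
    WinningCycle = ΔEL π i j < 0ℤ ⊎ (ΔEL π i j ≡ 0ℤ × ↧ t * ΔsumEL π i j ≤ ↥ t * + suc l)

    winningCycle? : Dec WinningCycle
    winningCycle? =
      (ΔEL π i j ℤ.<? 0ℤ) ⊎-dec (ΔEL π i j ℤ.≟ 0ℤ) ×-dec (↧ t * ΔsumEL π i j ℤ.≤? ↥ t * + suc l)

    winningCycle-descends : WinningCycle → ∃ λ R → ∀ r → R ℕ.≤ r →
                            ↧ t * (ΔsumEL π i j + + r * ΔEL π i j) - + suc l * ↥ t ≤ 0ℤ
    winningCycle-descends (inj₂ (W≡0 , qS≤pL)) = 0 , λ r _ →
      subst (λ W → ↧ t * (ΔsumEL π i j + + r * W) - + suc l * ↥ t ≤ 0ℤ) (sym W≡0)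
        (subst (_≤ 0ℤ) (sym (zero-cycle (↧ t) (ΔsumEL π i j) (+ r) (+ suc l) (↥ t)))
          (ℤ.i≤j⇒i-j≤0 qS≤pL))
      where
      zero-cycle : ∀ q s r L p → q * (s + r * 0ℤ) - L * p ≡ q * s - p * L
      zero-cycle = solve-∀
    winningCycle-descends (inj₁ W<0) with ΔEL π i j | W<0
    ... | + _ | ℤ.+<+ ()
    ... | -[1+ k ] | _ = ∣ D ∣ , λ r ∣D∣≤r →
      subst (_≤ 0ℤ) (sym (regroup (↧ t) (ΔsumEL π i j) (+ r) -[1+ k ] (+ suc l) (↥ t)))
        (eventually-nonpositive D (ℚ.denominator-1 t) k r ∣D∣≤r)
      where
      D = ↧ t * ΔsumEL π i j - + suc l * ↥ t
      regroup : ∀ q s r w L p → q * (s + r * w) - L * p ≡ (q * s - L * p) + q * (r * w)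
      regroup = solve-∀

  module Lasso {sinit} (ρ : Play G sinit) (fr : FirstRepetition (Play.π ρ)) where
    open Play ρ
    open FirstRepetition fr

    move : (s : Fin n) → Σ (Fin n) (λ s' → T (E s s'))
    move s with ℕ.anyUpTo? (λ k → π k Fin.≟ s) j
    ... | yes (k , _ , πk≡s) = π (suc k) , subst (λ x → T (E x (π (suc k)))) πk≡s (edges k)
    ... | no _ = total s

    next : Fin n → Fin n
    next s = proj₁ (move s)

    next-follows : ∀ {k} → k ℕ.< j → next (π k) ≡ π (suc k)
    next-follows {k} k<j with ℕ.anyUpTo? (λ k' → π k' Fin.≟ π k) j
    ... | yes (k' , k'<j , πk'≡πk) = cong (λ x → π (suc x)) (injective k'<j k<j πk'≡πk)
    ... | no none = ⊥-elim (none (k , k<j , refl))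

    strategy : Strategy₁ G
    strategy _ s _ = move s

    memoryless : Memoryless G strategy
    memoryless _ _ _ _ = refl

    module Follow (one : OnePlayer G) (τp : Play G sinit) (consistent : Consistent G strategy τp) where
      τ : ℕ → Fin n
      τ = Play.π τp

      step : ∀ k → τ (suc k) ≡ next (τ k)
      step k = consistent k (one (τ k))

      agrees : ∀ {k} → k ℕ.≤ j → τ k ≡ π k
      agrees = iterate-agree next step (trans (Play.start τp) (sym start)) next-follows

      periodic : Splice τ τ i j
      periodic = record
        { prefix = λ _ → refl
        ; suffix = iterate-shift next step
            (trans (agrees (ℕ.<⇒≤ i<j)) (trans repeats (sym (agrees ℕ.≤-refl)))) }

      ΔsumEL-agrees : ΔsumEL τ i j ≡ ΔsumEL π i j
      ΔsumEL-agrees = cong₂ _-_ (sumEL-cong agrees ℕ.≤-refl) (sumEL-cong agrees (ℕ.<⇒≤ i<j))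

      ΔEL-agrees : ΔEL τ i j ≡ ΔEL π i j
      ΔEL-agrees = cong₂ _-_ (EL-cong agrees ℕ.≤-refl) (EL-cong agrees (ℕ.<⇒≤ i<j))

    wins : OnePlayer G → (t : ℚ) → WinningCycle t fr → Winning G strategy sinit t
    wins one t winning τp consistent =
      bounded-excess⇒average-≤ (sumEL G τ) t (proj₁ bounded) (proj₂ bounded)
      where
      open Follow one τp consistent
      F : ℕ → ℤ
      F = excess (↧ t) (↥ t) τ
      F-step : ∀ r → F (r ℕ.+ j) ≡ F (r ℕ.+ i) + (↧ t * (ΔsumEL π i j + + r * ΔEL π i j) - + suc l * ↥ t)
      F-step r = trans (excess-splice periodic (↧ t) (↥ t) r)
        (cong₂ (λ s w → F (r ℕ.+ i) + (↧ t * (s + + r * w) - + suc l * ↥ t)) ΔsumEL-agrees ΔEL-agrees)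
      descends : ∀ r → proj₁ (winningCycle-descends t fr winning) ℕ.≤ r →
                 F (r ℕ.+ j) ≤ F (r ℕ.+ i)
      descends r R≤r = subst (_≤ F (r ℕ.+ i)) (sym (F-step r))
        (ℤ.≤-trans (ℤ.+-monoʳ-≤ (F (r ℕ.+ i)) (proj₂ (winningCycle-descends t fr winning) r R≤r))
                   (ℤ.≤-reflexive (ℤ.+-identityʳ (F (r ℕ.+ i)))))
      bounded = eventually-periodic-descent⇒bounded F i<j descends

  module CostBound (sinit : Fin n) (t : ℚ) where
    p q Q A : ℤ
    p = ↥ t
    q = ↧ t
    Q = + n * q
    A = + n * p + 1ℤ

    -- cost π m ≥ 0 says that the average energy of π up to m is at least t + 1/(n·q).
    cost : (ℕ → Fin n) → ℕ → ℤ
    cost = excess Q A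

    K : ℕ
    K = ∣ + n * (Q * energyFloor + + ∣ A ∣) ∣

    stretch-cost : ∀ {L S} → L ℕ.≤ n → - (+ L * energyFloor) ≤ S → - + K ≤ Q * S - + L * A
    stretch-cost {L} {S} L≤n S-lower = subst (λ k → - k ≤ Q * S - + L * A) (sym +K)
      (stretch-cost-lower 0≤Q 0≤floor (ℤ.+≤+ z≤n) (ℤ.+≤+ L≤n) S-lower)
      where
      0≤Q : 0ℤ ≤ Q
      0≤Q = 0≤* {+ n} (ℤ.+≤+ z≤n) (ℤ.+≤+ z≤n)
      0≤floor : 0ℤ ≤ energyFloor
      0≤floor = 0≤* {+ n} (ℤ.+≤+ z≤n) (ℤ.+≤+ z≤n)
      +K : + K ≡ + n * (Q * energyFloor + + ∣ A ∣)
      +K = ℤ.0≤i⇒+∣i∣≡i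
        (0≤* {+ n} (ℤ.+≤+ z≤n) (ℤ.+-mono-≤ (0≤* 0≤Q 0≤floor) (ℤ.+≤+ z≤n)))

    cut-cost : ∀ {π} (fr : FirstRepetition π) → ¬ WinningCycle t fr → ∀ d →
               let open FirstRepetition fr in
               cost (cut π i l) (d ℕ.+ i) - + (K ℕ.∸ d) ≤ cost π (d ℕ.+ j)
    cut-cost {π} fr losing d =
      subst (cost π' (d ℕ.+ i) - + (K ℕ.∸ d) ≤_) (sym (excess-splice (cut-splice fr) Q A d))
        (ℤ.+-monoʳ-≤ (cost π' (d ℕ.+ i)) (cycle-cost (ℤ.<-cmp W 0ℤ)))
      where
      open FirstRepetition fr
      π' = cut π i l
      S = ΔsumEL π i j
      W = ΔEL π i j
      L≤n : suc l ℕ.≤ n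
      L≤n = ℕ.≤-trans (ℕ.m≤m+n (suc l) i) j≤n
      cycle-cost : Tri (W < 0ℤ) (W ≡ 0ℤ) (0ℤ < W) → - + (K ℕ.∸ d) ≤ Q * (S + + d * W) - + suc l * A
      cycle-cost (tri< W<0 _ _) = ⊥-elim (losing (inj₁ W<0))
      cycle-cost (tri≈ _ W≡0 _) = ℤ.≤-trans (ℤ.neg-mono-≤ (ℤ.+≤+ z≤n))
        (subst (λ W → 0ℤ ≤ Q * (S + + d * W) - + suc l * A) (sym W≡0)
          (subst (λ x → 0ℤ ≤ Q * x - + suc l * A) (sym S+d*0≡S)
            (zero-cycle-cost (ℤ.+≤+ z≤n) (ℤ.+≤+ L≤n)
              (ℤ.≰⇒> λ qS≤pL → losing (inj₂ (W≡0 , qS≤pL))))))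
        where
        S+d*0≡S : S + + d * 0ℤ ≡ S
        S+d*0≡S = trans (cong (λ x → S + x) (ℤ.*-zeroʳ (+ d))) (ℤ.+-identityʳ S)
      cycle-cost (tri> _ _ 0<W) = ℤ.≤-trans (-[m∸n]≤n-m K d)
        (positive-cycle-cost {Q} {S} {W} {A} {+ suc l} 1≤Q 0<W (ℤ.+≤+ z≤n)
          (stretch-cost L≤n (ΔsumEL-lower π i (suc l) j≤n)))
        where
        1≤Q : 1ℤ ≤ Q
        1≤Q = subst (1ℤ ≤_) (ℤ.pos-* n (ℚ.denominatorℕ t))
          (ℤ.+≤+ (ℕ.*-mono-≤ (ℕ.≤-trans (s≤s z≤n) j≤n) (s≤s z≤n)))

    WinningLasso : Set
    WinningLasso = Σ (Play G sinit) λ ρ → WinningCycle t (firstRepetition (Play.π ρ))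

    CostBounded : ℕ → Set
    CostBounded m = ∀ b (ρ : Play G sinit) → let open FirstRepetition (firstRepetition (Play.π ρ)) in
                    m ℕ.< b ℕ.+ j → WinningLasso ⊎ - + (K ℕ.+ K ℕ.* (b ℕ.⊓ K)) ≤ cost (Play.π ρ) m

    -- Each cut costs at most K ∸ d, where d = m ∸ j is the length of the play beyond the
    -- cut cycle. As d strictly decreases from one cut to the next, the cuts cost at most
    -- K·(b ⊓ K) in total, and the cycle-free prefix that remains costs at most K.
    cost-bound : ∀ m → CostBounded m
    cost-bound = <-rec CostBounded bound
      where
      bound : ∀ m → (∀ {m'} → m' ℕ.< m → CostBounded m') → CostBounded m
      bound m rec b ρ = go
        where
        π = Play.π ρ
        fr = firstRepetition π
        open FirstRepetition fr
        go : m ℕ.< b ℕ.+ j → WinningLasso ⊎ - + (K ℕ.+ K ℕ.* (b ℕ.⊓ K)) ≤ cost π m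
        go m<b+j with m ℕ.<? j | winningCycle? t fr
        ... | yes m<j | _ = inj₂ (ℤ.≤-trans (ℤ.neg-mono-≤ (ℤ.+≤+ (ℕ.m≤m+n K _)))
                                   (stretch-cost m≤n (sumEL-lower π m m≤n)))
          where m≤n = ℕ.≤-trans (ℕ.<⇒≤ m<j) j≤n
        ... | no _ | yes winning = inj₁ (ρ , winning)
        ... | no m≮j | no losing = Sum.map₂ step (rec m'<m d ρ' m'<d+j')
          where
          d = m ℕ.∸ j
          d+j≡m : d ℕ.+ j ≡ m
          d+j≡m = ℕ.m∸n+n≡m (ℕ.≮⇒≥ m≮j)
          ρ' = cutCycle ρ fr
          m'<m : d ℕ.+ i ℕ.< m
          m'<m = subst (d ℕ.+ i ℕ.<_) d+j≡m (ℕ.+-monoʳ-< d i<j)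
          m'<d+j' : d ℕ.+ i ℕ.< d ℕ.+ FirstRepetition.j (firstRepetition (Play.π ρ'))
          m'<d+j' = ℕ.+-monoʳ-< d (repetition-beyond-prefix (Splice.prefix (cut-splice fr)) injective i<j
                                                              (firstRepetition (Play.π ρ')))
          d<b : d ℕ.< b
          d<b = ℕ.+-cancelʳ-< j d b (subst (ℕ._< b ℕ.+ j) (sym d+j≡m) m<b+j)
          step : - + (K ℕ.+ K ℕ.* (d ℕ.⊓ K)) ≤ cost (Play.π ρ') (d ℕ.+ i) →
                 - + (K ℕ.+ K ℕ.* (b ℕ.⊓ K)) ≤ cost π m
          step cost' = begin
            - + (K ℕ.+ K ℕ.* (b ℕ.⊓ K))
              ≤⟨ ℤ.neg-mono-≤ (ℤ.+≤+ potential) ⟩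
            - + (K ℕ.+ K ℕ.* (d ℕ.⊓ K) ℕ.+ (K ℕ.∸ d))
              ≡⟨ neg-split (K ℕ.+ K ℕ.* (d ℕ.⊓ K)) (K ℕ.∸ d) ⟩
            - + (K ℕ.+ K ℕ.* (d ℕ.⊓ K)) - + (K ℕ.∸ d)
              ≤⟨ ℤ.+-monoˡ-≤ (- + (K ℕ.∸ d)) cost' ⟩
            cost (Play.π ρ') (d ℕ.+ i) - + (K ℕ.∸ d)
              ≤⟨ cut-cost fr losing d ⟩
            cost π (d ℕ.+ j)
              ≡⟨ cong (cost π) d+j≡m ⟩
            cost π m ∎
            where
            open ℤ.≤-Reasoning
            potential : K ℕ.+ K ℕ.* (d ℕ.⊓ K) ℕ.+ (K ℕ.∸ d) ℕ.≤ K ℕ.+ K ℕ.* (b ℕ.⊓ K)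
            potential = subst (ℕ._≤ K ℕ.+ K ℕ.* (b ℕ.⊓ K)) (sym (ℕ.+-assoc K _ _))
              (ℕ.+-monoʳ-≤ K (potential-step K d<b))
            neg-split : ∀ x y → - + (x ℕ.+ y) ≡ - + x - + y
            neg-split x y = trans (cong -_ (ℤ.pos-+ x y)) (ℤ.neg-distrib-+ (+ x) (+ y))

    cost-bounded : ∀ (ρ : Play G sinit) m → WinningLasso ⊎ - + (K ℕ.+ K ℕ.* K) ≤ cost (Play.π ρ) m
    cost-bounded ρ m =
      Sum.map₂ (ℤ.≤-trans (ℤ.neg-mono-≤ (ℤ.+≤+ (ℕ.+-monoʳ-≤ K (ℕ.*-monoʳ-≤ K (ℕ.m⊓n≤n m K))))))
        (cost-bound m m ρ (ℕ.m<m+n m (ℕ.≤-trans (s≤s z≤n) i<j)))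
      where open FirstRepetition (firstRepetition (Play.π ρ))

    -- ε < 1/(n·q), the slack built into cost.
    ε : ℚ
    ε = mkℚ (+ 1) (n ℕ.* ℚ.denominatorℕ t) (1-coprimeTo _)

    0<ε : ℚ.0ℚ ℚ.< ε
    0<ε = ℚ.*<* (ℤ.+<+ (s≤s z≤n))

    bounded-cost⇒short : ∀ π m K' → - + K' ≤ cost π (suc m) →
                         sumEL G π (suc m) ℚ./ suc m ℚ.≤ t ℚ.+ ε →
                         suc m ℕ.≤ suc (n ℕ.* ℚ.denominatorℕ t) ℕ.* K'
    bounded-cost⇒short π m K' cheap average = ℤ.drop‿+≤+ (subst (+ suc m ≤_) E*K'
      (average-gap {+ n} {q} {p} {sumEL G π (suc m)} (ℤ.+≤+ z≤n) (ℤ.+≤+ z≤n)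
        (subst (λ e → sumEL G π (suc m) * (q * e) ≤ (p * e + 1ℤ * q) * + suc m) (sym +E)
          (Equivalence.to (/≤+⇔ (sumEL G π (suc m)) m t ε) average))
        cheap))
      where
      +E : 1ℤ + + n * q ≡ + suc (n ℕ.* ℚ.denominatorℕ t)
      +E = cong (λ x → 1ℤ + x) (sym (ℤ.pos-* n (ℚ.denominatorℕ t)))
      E*K' : (1ℤ + + n * q) * + K' ≡ + (suc (n ℕ.* ℚ.denominatorℕ t) ℕ.* K')
      E*K' = trans (cong (_* + K') +E) (sym (ℤ.pos-* (suc (n ℕ.* ℚ.denominatorℕ t)) K'))

-- The play of a strategy in a one-player game

module _ {n : ℕ} (G : Game n) (one : OnePlayer G) (σ : Strategy₁ G) (sinit : Fin n) where

  advance : List (Fin n) × Fin n → List (Fin n) × Fin n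
  advance (h , s) = h ∷ʳ s , proj₁ (σ h s (one s))

  run : ℕ → List (Fin n) × Fin n
  run zero = [] , sinit
  run (suc k) = advance (run k)

  outcome : Play G sinit
  outcome = record
    { π = λ k → proj₂ (run k)
    ; start = refl
    ; edges = λ k → proj₂ (σ (proj₁ (run k)) (proj₂ (run k)) (one (proj₂ (run k)))) }

  history : ∀ k → proj₁ (run k) ≡ map (Play.π outcome) (upTo k)
  history zero = refl
  history (suc k) = trans (cong (_∷ʳ proj₂ (run k)) (history k))
    (trans (sym (List.map-++ (Play.π outcome) (upTo k) _))
           (cong (map (Play.π outcome)) (List.upTo-∷ʳ k)))

  outcome-consistent : Consistent G σ outcome
  outcome-consistent k o = cong₂ (λ h o → proj₁ (σ h (proj₂ (run k)) o)) (history k)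
    (Decidable⇒UIP.≡-irrelevant Bool._≟_ (one (proj₂ (run k))) o)

theorem1 : {n : ℕ} (G : Game n) → OnePlayer G → (sinit : Fin n) (t : ℚ) →
           Σ (Strategy₁ G) (λ σ → Winning G σ sinit t) →
           Σ (Strategy₁ G) (λ σ → Memoryless G σ × Winning G σ sinit t)
theorem1 {n} G one sinit t (σ , σ-wins) =
  Sum.[ memorylessLasso , (λ cheap → ⊥-elim (ℕ.<⇒≱ long (short cheap))) ] (cost-bounded ρ (suc m))
  where
  open CostBound G sinit t
  ρ = outcome G one σ sinit
  average = σ-wins ρ (outcome-consistent G one σ sinit) ε 0<ε
  K₁ = K ℕ.+ K ℕ.* K
  m = proj₁ average ℕ.+ suc (n ℕ.* ℚ.denominatorℕ t) ℕ.* K₁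
  long : suc (n ℕ.* ℚ.denominatorℕ t) ℕ.* K₁ ℕ.< suc m
  long = s≤s (ℕ.m≤n+m _ (proj₁ average))
  short : - + K₁ ≤ cost (Play.π ρ) (suc m) → suc m ℕ.≤ suc (n ℕ.* ℚ.denominatorℕ t) ℕ.* K₁
  short cheap = bounded-cost⇒short (Play.π ρ) m K₁ cheap (proj₂ average m (ℕ.m≤m+n _ _))
  memorylessLasso : WinningLasso → Σ (Strategy₁ G) (λ σ → Memoryless G σ × Winning G σ sinit t)
  memorylessLasso (ρ' , winning) = strategy , memoryless , wins one t winning
    where open Lasso G ρ' (firstRepetition (Play.π ρ'))
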